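{- Let $\mathcal{G}$ be a semicomplete digraph with exactly one cycle which does not have both a source and a sink. Then $\mathrm{id\mbox{ - }Pol}(\mathcal{G})$ has the PGP.
   Context: A semicomplete digraph is a finite irreflexive digraph in which for all distinct vertices $x,y$ at least one of $(x,y),(y,x)$ is an edge. Cycles are directed cycles (two opposite edges form a cycle of length 2). Source/sink: vertex of in-degree/out-degree zero. $\mathrm{id\mbox{ - }Pol}(\mathcal{G})$ is the set of idempotent polymorphisms of $\mathcal{G}$ (maps $f:G^k\to G$ preserving edges coordinatewise with $f(a,\dots,a)=a$), viewed as an algebra $\mathbb{A}$; $S\subseteq G^m$ generates $\mathbb{A}^m$ if every tuple of $G^m$ is obtained by applying some $f\in\mathrm{id\mbox{ - }Pol}(\mathcal{G})$ coordinatewise to elements of $S$; PGP means the minimum size of a generating set of $\mathbb{A}^m$ is $O(p(m))$ for some polynomial $p$. -}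

module Defs where

open import Data.Nat using (ℕ; zero; suc; _+_; _*_; _^_; _≤_)
open import Data.Fin using (Fin)
open import Data.Bool using (Bool; true)
open import Data.List using (List; []; _∷_; _++_; length; drop; take; lookup)
open import Data.List.Relation.Unary.Unique.Propositional using (Unique)
open import Data.Product using (Σ; ∃; ∃-syntax; _×_)
open import Data.Sum using (_⊎_)
open import Data.Unit using (⊤)
open import Relation.Binary.PropositionalEquality using (_≡_; _≢_)
open import Relation.Nullary using (¬_)

record Digraph : Set where
  field
    n    : ℕ
    edge : Fin n → Fin n → Bool

open Digraph public

Vertex : Digraph → Set
Vertex G = Fin (n G)

E : (G : Digraph) → Vertex G → Vertex G → Set
E G x y = edge G x y ≡ true

Irreflexive : Digraph → Set
Irreflexive G = ∀ x → ¬ E G x x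

Semicomplete : Digraph → Set
Semicomplete G = Irreflexive G × (∀ x y → x ≢ y → E G x y ⊎ E G y x)

Walk : (G : Digraph) → List (Vertex G) → Set
Walk G []           = ⊤
Walk G (x ∷ [])     = ⊤
Walk G (x ∷ y ∷ xs) = E G x y × Walk G (y ∷ xs)

ClosedWalk : (G : Digraph) → List (Vertex G) → Set
ClosedWalk G []       = ⊤
ClosedWalk G (x ∷ xs) = Walk G (x ∷ xs ++ x ∷ [])

IsCycle : (G : Digraph) → List (Vertex G) → Set
IsCycle G cs = 2 ≤ length cs × Unique cs × ClosedWalk G cs

-- two vertex sequences describe the same cycle iff one is a rotation of the other
SameCycle : {A : Set} → List A → List A → Set
SameCycle xs ys = ∃[ i ] (drop i xs ++ take i xs ≡ ys)

ExactlyOneCycle : Digraph → Set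
ExactlyOneCycle G =
  Σ (List (Vertex G)) λ c → IsCycle G c × (∀ d → IsCycle G d → SameCycle c d)

IsSource : (G : Digraph) → Vertex G → Set
IsSource G x = ∀ y → ¬ E G y x

IsSink : (G : Digraph) → Vertex G → Set
IsSink G x = ∀ y → ¬ E G x y

HasSourceAndSink : Digraph → Set
HasSourceAndSink G = (∃[ x ] IsSource G x) × (∃[ y ] IsSink G y)

Op : Digraph → ℕ → Set
Op G k = (Fin k → Vertex G) → Vertex G

IsPolymorphism : (G : Digraph) {k : ℕ} → Op G k → Set
IsPolymorphism G {k} f =
  ∀ (a b : Fin k → Vertex G) → (∀ i → E G (a i) (b i)) → E G (f a) (f b)

IsIdempotent : (G : Digraph) {k : ℕ} → Op G k → Set
IsIdempotent G f = ∀ a → f (λ _ → a) ≡ a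

IsIdPol : (G : Digraph) {k : ℕ} → Op G k → Set
IsIdPol G f = IsPolymorphism G f × IsIdempotent G f

-- S ⊆ G^m generates 𝔸^m (𝔸 = id-Pol(G)): every tuple t ∈ G^m equals
-- f(s₁,…,s_k) computed coordinatewise for some f ∈ id-Pol(G) and s₁,…,s_k ∈ S
Generates : (G : Digraph) (m : ℕ) → List (Fin m → Vertex G) → Set
Generates G m S =
  ∀ (t : Fin m → Vertex G) →
    ∃[ k ] Σ (Op G k) λ f → IsIdPol G f ×
      Σ (Fin k → Fin (length S)) λ ι →
        ∀ j → t j ≡ f (λ i → lookup S (ι i) j)

-- PGP: the minimum size of a generating set of 𝔸^m is O(p(m)) for a polynomial p;
-- equivalently there are d, c, m₀ with a generating set of size ≤ c·m^d for all m ≥ m₀.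
HasPGP : Digraph → Set
HasPGP G =
  ∃[ d ] ∃[ c ] ∃[ m₀ ] ∀ m → m₀ ≤ m →
    Σ (List (Fin m → Vertex G)) λ S → Generates G m S × length S ≤ c * m ^ d

-- Reversing all edges if necessary, we may assume that G has no sink. Let K be the vertex
-- set of the unique cycle; it has 2 or 3 vertices, since a longer cycle has a chord. Outside K
-- every 2- and 3-cycle is excluded, so G − K is a transitive tournament, and a greatest vertex
-- of G − K entered from K could not leave without closing a cycle; hence every vertex outside
-- K points to all of K and K is closed under out-edges. So
--   φ(x, y, z) = majority(x, y, z) on K³, and otherwise the lowest of x, y, z
-- (in the order given by the edges, with K on top) is an idempotent polymorphism. A tuple t
-- splits as φ(t′, t′, t″), where t′ keeps the entries of t in K and t″ the others, both padded
-- with a fixed κ ∈ K: the majority recursion builds t′ and φ(x, x, −) joins the entries of t″,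
-- from the tuples with at most two entries different from κ — at most (|G| m)² of them.

module Submission where

open import Data.Bool using (true; if_then_else_)
open import Data.Bool.Properties using () renaming (_≟_ to _≟ᵇ_)
open import Data.Empty using (⊥; ⊥-elim)
open import Data.Fin using (Fin; zero; _≟_; cast; combine; remQuot)
open import Data.Fin.Properties using (any?; all?; remQuot-combine)
open import Data.List using (List; []; _∷_; _++_; drop; take; length; lookup; tabulate; allFin)
open import Data.List.Properties using (take++drop≡id; length-tabulate; lookup-tabulate)
open import Data.List.Membership.Propositional using (_∈_)
open import Data.List.Membership.Propositional.Properties using (∈-allFin)
import Data.List.Membership.DecPropositional as DecMembership
open import Data.List.Relation.Unary.Any using (here; there)
open import Data.List.Relation.Unary.All using ([]; _∷_)
open import Data.List.Relation.Unary.All.Properties using (All¬⇒¬Any)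
open import Data.List.Relation.Unary.AllPairs using ([]; _∷_)
open import Data.List.Relation.Binary.Permutation.Propositional using (_↭_; ↭-sym)
open import Data.List.Relation.Binary.Permutation.Propositional.Properties using (∈-resp-↭; ++-comm)
open import Data.Vec using (Vec; []; _∷_) renaming (allFin to allFinᵛ)
open import Data.Vec.Membership.Propositional using () renaming (_∈_ to _∈ᵛ_)
open import Data.Vec.Membership.Propositional.Properties using (∈-allFin⁺)
import Data.Vec.Relation.Unary.Any as VecAny
open import Data.Nat using (ℕ; suc; _*_; _^_; _≤_; s≤s; z≤n)
open import Data.Nat.Properties using (≤-reflexive; *-identityʳ)
open import Data.Product using (Σ; ∃; ∃₂; _×_; _,_; proj₁; proj₂)
open import Data.Sum using (_⊎_; inj₁; inj₂; [_,_]; [_,_]′)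
import Data.Sum as Sum
open import Data.Unit using (tt)
open import Function using (_∘_; id)
open import Relation.Binary.PropositionalEquality hiding ([_])
open import Relation.Nullary using (¬_; Dec; yes; no; does; contradiction)
open import Relation.Nullary.Decidable using (_×-dec_; ¬?)

open import Defs

converse : Digraph → Digraph
converse G = record { n = n G ; edge = λ x y → edge G y x }

E? : (G : Digraph) → ∀ x y → Dec (E G x y)
E? G x y = edge G x y ≟ᵇ true

¬sink⇒successor : (G : Digraph) → ¬ ∃ (IsSink G) → ∀ x → ∃ (E G x)
¬sink⇒successor G no-sink x with any? (E? G x)
... | yes x→y = x→y
... | no ¬x→y = contradiction (x , λ y xy → ¬x→y (y , xy)) no-sink

Generates-converse : ∀ G {m} S → Generates (converse G) m S → Generates G m S
Generates-converse G S generates t with generates t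
... | k , f , (pol , idem) , ι , t≡f = k , f , ((λ a b ab → pol b a ab) , idem) , ι , t≡f

module _ {ν} (R : Fin ν → Fin ν → Set) {P : Fin ν → Set} (P? : ∀ x → Dec (P x))
         (total : ∀ {x y} → P x → P y → x ≢ y → R x y ⊎ R y x)
         (trans-R : ∀ {x y z} → P x → R x y → R y z → R x z) where

  empty-or-greatest : (xs : List (Fin ν)) →
    (∀ {y} → y ∈ xs → ¬ P y) ⊎ ∃ λ w → P w × (∀ {y} → y ∈ xs → P y → y ≡ w ⊎ R y w)
  empty-or-greatest [] = inj₁ λ ()
  empty-or-greatest (x ∷ xs) with P? x | empty-or-greatest xs
  ... | no ¬px | inj₁ none = inj₁ λ { (here refl) → ¬px ; (there y∈) → none y∈ }
  ... | no ¬px | inj₂ (w , pw , top) =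
    inj₂ (w , pw , λ { (here refl) px → contradiction px ¬px ; (there y∈) → top y∈ })
  ... | yes px | inj₁ none =
    inj₂ (x , px , λ { (here refl) _ → inj₁ refl ; (there y∈) py → contradiction py (none y∈) })
  ... | yes px | inj₂ (w , pw , top) with x ≟ w
  ...   | yes refl = inj₂ (w , pw , λ { (here refl) _ → inj₁ refl ; (there y∈) → top y∈ })
  ...   | no x≢w with total px pw x≢w
  ...     | inj₁ xw = inj₂ (w , pw , λ { (here refl) _ → inj₂ xw ; (there y∈) → top y∈ })
  ...     | inj₂ wx = inj₂ (x , px , λ
              { (here refl) _ → inj₁ refl
              ; (there y∈) py → inj₂ ([ (λ { refl → wx }) , (λ yw → trans-R py yw wx) ] (top y∈ py)) })

SameCycle⇒↭ : ∀ {A : Set} {xs ys : List A} → SameCycle xs ys → xs ↭ ys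
SameCycle⇒↭ {xs = xs} (i , refl) =
  subst (_↭ drop i xs ++ take i xs) (take++drop≡id i xs) (++-comm (take i xs) (drop i xs))

pair-pigeonhole : ∀ {A : Set} {a b x y z : A} →
  x ∈ a ∷ b ∷ [] → y ∈ a ∷ b ∷ [] → z ∈ a ∷ b ∷ [] → x ≢ y → x ≢ z → y ≡ z
pair-pigeonhole _ (here refl)         (here refl)         _ _ = refl
pair-pigeonhole _ (there (here refl)) (there (here refl)) _ _ = refl
pair-pigeonhole (here refl)         (here refl)         _ x≢y _ = contradiction refl x≢y
pair-pigeonhole (here refl)         _ (here refl)         _ x≢z = contradiction refl x≢z
pair-pigeonhole (there (here refl)) (there (here refl)) _ x≢y _ = contradiction refl x≢y
pair-pigeonhole (there (here refl)) _ (there (here refl)) _ x≢z = contradiction refl x≢z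
pair-pigeonhole (there (there ())) _ _ _ _
pair-pigeonhole _ (there (there ())) _ _ _
pair-pigeonhole _ _ (there (there ())) _ _

-- Terms over one ternary operation

data Term (I : Set) : Set where
  var  : I → Term I
  node : Term I → Term I → Term I → Term I

module Evaluation {A : Set} (op : A → A → A → A) where

  ⟦_⟧ : ∀ {I} → Term I → (I → A) → A
  ⟦ var i ⟧      ρ = ρ i
  ⟦ node p q r ⟧ ρ = op (⟦ p ⟧ ρ) (⟦ q ⟧ ρ) (⟦ r ⟧ ρ)

  cong-op : ∀ {x y z x′ y′ z′} → x ≡ x′ → y ≡ y′ → z ≡ z′ → op x y z ≡ op x′ y′ z′
  cong-op refl refl refl = refl

  ⟦⟧-cong : ∀ {I} (τ : Term I) {ρ σ : I → A} → (∀ i → ρ i ≡ σ i) → ⟦ τ ⟧ ρ ≡ ⟦ τ ⟧ σ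
  ⟦⟧-cong (var i)      ρ≡σ = ρ≡σ i
  ⟦⟧-cong (node p q r) ρ≡σ = cong-op (⟦⟧-cong p ρ≡σ) (⟦⟧-cong q ρ≡σ) (⟦⟧-cong r ρ≡σ)

  ⟦⟧-preserves : (R : A → A → Set) →
    (∀ {x y z x′ y′ z′} → R x x′ → R y y′ → R z z′ → R (op x y z) (op x′ y′ z′)) →
    ∀ {I} (τ : Term I) {ρ σ : I → A} → (∀ i → R (ρ i) (σ i)) → R (⟦ τ ⟧ ρ) (⟦ τ ⟧ σ)
  ⟦⟧-preserves R op-preserves (var i)      ρRσ = ρRσ i
  ⟦⟧-preserves R op-preserves (node p q r) ρRσ =
    op-preserves (⟦⟧-preserves R op-preserves p ρRσ) (⟦⟧-preserves R op-preserves q ρRσ)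
                 (⟦⟧-preserves R op-preserves r ρRσ)

  ⟦⟧-idempotent : (∀ x → op x x x ≡ x) → ∀ {I} (τ : Term I) x → ⟦ τ ⟧ (λ _ → x) ≡ x
  ⟦⟧-idempotent op-idem (var i)      x = refl
  ⟦⟧-idempotent op-idem (node p q r) x =
    trans (cong-op (⟦⟧-idempotent op-idem p x) (⟦⟧-idempotent op-idem q x) (⟦⟧-idempotent op-idem r x))
          (op-idem x)

module _ (G : Digraph) (op : Vertex G → Vertex G → Vertex G → Vertex G)
         (op-preserves-E : ∀ {x y z x′ y′ z′} → E G x x′ → E G y y′ → E G z z′ →
                           E G (op x y z) (op x′ y′ z′))
         (op-idempotent : ∀ x → op x x x ≡ x) where
  open Evaluation op

  Generates-tabulate : ∀ {I : Set} {m N} (g : I → Fin m → Vertex G)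
    (encode : I → Fin N) (decode : Fin N → I) → (∀ q → decode (encode q) ≡ q) →
    (∀ t → Σ (Term I) λ τ → ∀ j → ⟦ τ ⟧ (λ q → g q j) ≡ t j) →
    Generates G m (tabulate (g ∘ decode))
  Generates-tabulate {N = N} g encode decode decode∘encode term t with term t
  ... | τ , τ≡t = N , f , (polymorphism , idempotent) , ι , t≡f
    where
      f : Op G N
      f u = ⟦ τ ⟧ (u ∘ encode)

      polymorphism : IsPolymorphism G f
      polymorphism a b ab = ⟦⟧-preserves (E G) op-preserves-E τ (ab ∘ encode)

      idempotent : IsIdempotent G f
      idempotent = ⟦⟧-idempotent op-idempotent τ

      ι : Fin N → Fin (length (tabulate (g ∘ decode)))
      ι = cast (sym (length-tabulate (g ∘ decode)))

      lookup-encode : ∀ q j → lookup (tabulate (g ∘ decode)) (ι (encode q)) j ≡ g q j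
      lookup-encode q j =
        trans (cong (λ s → s j) (lookup-tabulate (g ∘ decode) (encode q)))
              (cong (λ q′ → g q′ j) (decode∘encode q))

      t≡f : ∀ j → t j ≡ f (λ i → lookup (tabulate (g ∘ decode)) (ι i) j)
      t≡f j = trans (sym (τ≡t j)) (⟦⟧-cong τ (λ q → sym (lookup-encode q j)))

-- Consequences of having a unique cycle

record IsShortCycle (G : Digraph) (K : Vertex G → Set) : Set where
  field
    functional : ∀ {x y y′} → K x → K y → K y′ → E G x y → E G x y′ → y ≡ y′
    injective  : ∀ {x x′ y} → K x → K x′ → K y → E G x y → E G x′ y → x ≡ x′
    reach₂     : ∀ {x y} → K x → K y → x ≢ y → E G x y ⊎ ∃ λ t → K t × E G x t × E G t y

-- What the construction uses of "K is the vertex set of the only cycle of G"; unlike the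
-- cycle itself, these properties are invariant under reversing every edge.
record IsUniqueCycle (G : Digraph) (K : Vertex G → Set) : Set where
  field
    semicomplete : Semicomplete G
    K?           : ∀ x → Dec (K x)
    κ            : Vertex G
    κ∈K          : K κ
    2-cycle⇒K    : ∀ {u v} → E G u v → E G v u → K u
    3-cycle⇒K    : ∀ {u v w} → E G u v → E G v w → E G w u → K u
    short-cycle  : IsShortCycle G K

converse-IsShortCycle : ∀ {G K} → IsShortCycle G K → IsShortCycle (converse G) K
converse-IsShortCycle S = record
  { functional = λ kx ky ky′ xy xy′ → injective ky ky′ kx xy xy′
  ; injective  = λ kx kx′ ky xy x′y → functional ky kx kx′ xy x′y
  ; reach₂     = λ kx ky x≢y →
      Sum.map₂ (λ { (t , kt , yt , tx) → t , kt , tx , yt }) (reach₂ ky kx (≢-sym x≢y))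
  }
  where open IsShortCycle S

converse-IsUniqueCycle : ∀ {G K} → IsUniqueCycle G K → IsUniqueCycle (converse G) K
converse-IsUniqueCycle U = record
  { semicomplete = proj₁ semicomplete , λ x y x≢y → Sum.swap (proj₂ semicomplete x y x≢y)
  ; K?           = K?
  ; κ            = κ
  ; κ∈K          = κ∈K
  ; 2-cycle⇒K    = λ vu uv → 2-cycle⇒K uv vu
  ; 3-cycle⇒K    = λ vu wv uw → 3-cycle⇒K uw wv vu
  ; short-cycle  = converse-IsShortCycle short-cycle
  }
  where open IsUniqueCycle U

module _ {G : Digraph} (sc : Semicomplete G) where

  UniqueCycle : List (Vertex G) → Set
  UniqueCycle c = ∀ d → IsCycle G d → SameCycle c d

  edge⇒≢ : ∀ {u v} → E G u v → u ≢ v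
  edge⇒≢ {u} uv refl = proj₁ sc u uv

  digon : ∀ {u v} → E G u v → E G v u → IsCycle G (u ∷ v ∷ [])
  digon uv vu = s≤s (s≤s z≤n) , (edge⇒≢ uv ∷ []) ∷ [] ∷ [] , uv , vu , tt

  triangle : ∀ {u v w} → E G u v → E G v w → E G w u → IsCycle G (u ∷ v ∷ w ∷ [])
  triangle uv vw wu =
    s≤s (s≤s z≤n) , (edge⇒≢ uv ∷ ≢-sym (edge⇒≢ wu) ∷ []) ∷ (edge⇒≢ vw ∷ []) ∷ [] ∷ [] ,
    uv , vw , wu , tt

  module _ {c} (unique : UniqueCycle c) where

    cycle⊆c : ∀ {d x} → IsCycle G d → x ∈ d → x ∈ c
    cycle⊆c d-cycle = ∈-resp-↭ (↭-sym (SameCycle⇒↭ (unique _ d-cycle)))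

    c⊆cycle : ∀ {d x} → IsCycle G d → x ∈ c → x ∈ d
    c⊆cycle d-cycle = ∈-resp-↭ (SameCycle⇒↭ (unique _ d-cycle))

  -- A cycle of length at least 4 has a chord, which closes a shorter cycle missing a vertex.
  no-long-cycle : ∀ {x₀ x₁ x₂ x₃ xs} → IsCycle G (x₀ ∷ x₁ ∷ x₂ ∷ x₃ ∷ xs) →
                  ¬ UniqueCycle (x₀ ∷ x₁ ∷ x₂ ∷ x₃ ∷ xs)
  no-long-cycle {x₀} {x₁} {x₂} {x₃} {xs}
    (_ , (x₀≢x₁ ∷ x₀≢rest@(x₀≢x₂ ∷ x₀≢x₃ ∷ _)) ∷ x₁≢rest@(_ ∷ x₁≢x₃ ∷ _)
       ∷ distinct@((x₂≢x₃ ∷ _) ∷ _) , x₀x₁ , x₁x₂ , walk) unique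
    with proj₂ sc x₀ x₂ x₀≢x₂
  ... | inj₁ x₀x₂ = x₁∉shortcut (c⊆cycle unique shortcut (there (here refl)))
    where
      shortcut : IsCycle G (x₀ ∷ x₂ ∷ x₃ ∷ xs)
      shortcut = s≤s (s≤s z≤n) , x₀≢rest ∷ distinct , x₀x₂ , walk

      x₁∉shortcut : ¬ x₁ ∈ x₀ ∷ x₂ ∷ x₃ ∷ xs
      x₁∉shortcut (here x₁≡x₀) = x₀≢x₁ (sym x₁≡x₀)
      x₁∉shortcut (there x₁∈)  = All¬⇒¬Any x₁≢rest x₁∈
  ... | inj₂ x₂x₀ =
    All¬⇒¬Any (≢-sym x₀≢x₃ ∷ ≢-sym x₁≢x₃ ∷ ≢-sym x₂≢x₃ ∷ [])
              (c⊆cycle unique (triangle x₀x₁ x₁x₂ x₂x₀) (there (there (there (here refl)))))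

  digon-IsShortCycle : ∀ {a b} → E G a b → E G b a → IsShortCycle G (_∈ a ∷ b ∷ [])
  digon-IsShortCycle {a} {b} ab ba = record
    { functional = λ kx ky ky′ xy xy′ → pair-pigeonhole kx ky ky′ (edge⇒≢ xy) (edge⇒≢ xy′)
    ; injective  = λ kx kx′ ky xy x′y →
        pair-pigeonhole ky kx kx′ (≢-sym (edge⇒≢ xy)) (≢-sym (edge⇒≢ x′y))
    ; reach₂     = reach₂
    }
    where
      reach₂ : ∀ {x y} → x ∈ a ∷ b ∷ [] → y ∈ a ∷ b ∷ [] → x ≢ y →
               E G x y ⊎ ∃ λ t → t ∈ a ∷ b ∷ [] × E G x t × E G t y
      reach₂ (here refl)         (there (here refl)) _   = inj₁ ab
      reach₂ (there (here refl)) (here refl)         _   = inj₁ ba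
      reach₂ (here refl)         (here refl)         x≢y = contradiction refl x≢y
      reach₂ (there (here refl)) (there (here refl)) x≢y = contradiction refl x≢y
      reach₂ (there (there ())) _ _
      reach₂ _ (there (there ())) _

  module _ {a b d} (unique : UniqueCycle (a ∷ b ∷ d ∷ [])) (a≢b : a ≢ b) (a≢d : a ≢ d) (b≢d : b ≢ d)
           (ab : E G a b) (bd : E G b d) (da : E G d a) where

    private
      K : Vertex G → Set
      K = _∈ a ∷ b ∷ d ∷ []

    no-digon : ∀ {u v} → E G u v → E G v u → ⊥
    no-digon {u} {v} uv vu = b≢d (pair-pigeonhole (⊆ (here refl)) (⊆ (there (here refl)))
                                                   (⊆ (there (there (here refl)))) a≢b a≢d)
      where
        ⊆ : ∀ {x} → K x → x ∈ u ∷ v ∷ []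
        ⊆ = c⊆cycle unique (digon uv vu)

    Triangle : Vertex G → Vertex G → Vertex G → Set
    Triangle u v w = E G u v × E G v w × E G w u × (∀ {y} → K y → y ≡ u ⊎ y ≡ v ⊎ y ≡ w)

    rotation : ∀ {x} → K x → ∃₂ (Triangle x)
    rotation (here refl) = b , d , ab , bd , da , λ
      { (here refl) → inj₁ refl ; (there (here refl)) → inj₂ (inj₁ refl)
      ; (there (there (here refl))) → inj₂ (inj₂ refl) ; (there (there (there ()))) }
    rotation (there (here refl)) = d , a , bd , da , ab , λ
      { (here refl) → inj₂ (inj₂ refl) ; (there (here refl)) → inj₁ refl
      ; (there (there (here refl))) → inj₂ (inj₁ refl) ; (there (there (there ()))) }
    rotation (there (there (here refl))) = a , b , da , ab , bd , λ
      { (here refl) → inj₂ (inj₁ refl) ; (there (here refl)) → inj₂ (inj₂ refl)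
      ; (there (there (here refl))) → inj₁ refl ; (there (there (there ()))) }
    rotation (there (there (there ())))

    out-unique : ∀ {u v w y} → Triangle u v w → K y → E G u y → y ≡ v
    out-unique (_ , _ , wu , cover) ky uy with cover ky
    ... | inj₁ refl        = contradiction uy (proj₁ sc _)
    ... | inj₂ (inj₁ refl) = refl
    ... | inj₂ (inj₂ refl) = ⊥-elim (no-digon wu uy)

    in-unique : ∀ {u v w y} → Triangle u v w → K y → E G y u → y ≡ w
    in-unique (uv , _ , _ , cover) ky yu with cover ky
    ... | inj₁ refl        = contradiction yu (proj₁ sc _)
    ... | inj₂ (inj₁ refl) = ⊥-elim (no-digon uv yu)
    ... | inj₂ (inj₂ refl) = refl

    reach-from : ∀ {u v w y} → Triangle u v w → K y → u ≢ y →
                 E G u y ⊎ ∃ λ t → K t × E G u t × E G t y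
    reach-from (uv , vw , wu , cover) ky u≢y with cover ky
    ... | inj₁ refl        = contradiction refl u≢y
    ... | inj₂ (inj₁ refl) = inj₁ uv
    ... | inj₂ (inj₂ refl) = inj₂ (_ , cycle⊆c unique (triangle uv vw wu) (there (here refl)) , uv , vw)

    triangle-IsShortCycle : IsShortCycle G K
    triangle-IsShortCycle = record
      { functional = λ kx ky ky′ xy xy′ → let (_ , _ , T) = rotation kx in
                       trans (out-unique T ky xy) (sym (out-unique T ky′ xy′))
      ; injective  = λ kx kx′ ky xy x′y → let (_ , _ , T) = rotation ky in
                       trans (in-unique T kx xy) (sym (in-unique T kx′ x′y))
      ; reach₂     = λ kx ky x≢y → reach-from (proj₂ (proj₂ (rotation kx))) ky x≢y
      }

  cycle-IsShortCycle : ∀ c → IsCycle G c → UniqueCycle c → IsShortCycle G (_∈ c)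
  cycle-IsShortCycle []                 (() , _)                _
  cycle-IsShortCycle (_ ∷ [])           (s≤s () , _)            _
  cycle-IsShortCycle (_ ∷ _ ∷ [])       (_ , _ , ab , ba , _)   _ = digon-IsShortCycle ab ba
  cycle-IsShortCycle (_ ∷ _ ∷ _ ∷ [])
    (_ , (a≢b ∷ a≢d ∷ []) ∷ (b≢d ∷ []) ∷ _ , ab , bd , da , _) unique =
    triangle-IsShortCycle unique a≢b a≢d b≢d ab bd da
  cycle-IsShortCycle (_ ∷ _ ∷ _ ∷ _ ∷ _) c-cycle unique = ⊥-elim (no-long-cycle c-cycle unique)

  cycle-vertex : ∀ {c} → IsCycle G c → ∃ (_∈ c)
  cycle-vertex {x ∷ _} _ = x , here refl

  isUniqueCycle : ∀ c → IsCycle G c → UniqueCycle c → IsUniqueCycle G (_∈ c)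
  isUniqueCycle c c-cycle unique = record
    { semicomplete = sc
    ; K?           = λ x → DecMembership._∈?_ _≟_ x c
    ; κ            = proj₁ (cycle-vertex c-cycle)
    ; κ∈K          = proj₂ (cycle-vertex c-cycle)
    ; 2-cycle⇒K    = λ uv vu → cycle⊆c unique (digon uv vu) (here refl)
    ; 3-cycle⇒K    = λ uv vw wu → cycle⊆c unique (triangle uv vw wu) (here refl)
    ; short-cycle  = cycle-IsShortCycle c c-cycle unique
    }

-- The polymorphism φ and the generating sets

module Construction {G : Digraph} {K : Vertex G → Set} (U : IsUniqueCycle G K)
                    (successor : ∀ x → ∃ (E G x)) where
  open IsUniqueCycle U
  open IsShortCycle short-cycle

  private
    V : Set
    V = Vertex G

    total : ∀ x y → x ≢ y → E G x y ⊎ E G y x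
    total = proj₂ semicomplete

    irrefl : Irreflexive G
    irrefl = proj₁ semicomplete

  K-≢ : ∀ {x y} → K x → ¬ K y → x ≢ y
  K-≢ x∈K y∉K refl = y∉K x∈K

  trans-outside : ∀ {u v w} → ¬ K u → E G u v → E G v w → E G u w
  trans-outside {u} {v} {w} u∉K uv vw with u ≟ w
  ... | yes refl = contradiction (2-cycle⇒K uv vw) u∉K
  ... | no u≢w with total u w u≢w
  ...   | inj₁ uw = uw
  ...   | inj₂ wu = contradiction (3-cycle⇒K uv vw wu) u∉K

  no-detour : ∀ {v w z} → K v → ¬ K w → K z → E G v w → E G w z → ⊥
  no-detour {v} {w} {z} v∈K w∉K z∈K vw wz with z ≟ v
  ... | yes refl = w∉K (2-cycle⇒K wz vw)
  ... | no z≢v with reach₂ z∈K v∈K z≢v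
  ...   | inj₁ zv = w∉K (3-cycle⇒K wz zv vw)
  ...   | inj₂ (t , t∈K , zt , tv) with total w t (≢-sym (K-≢ t∈K w∉K))
  ...     | inj₁ wt = w∉K (3-cycle⇒K wt tv vw)
  ...     | inj₂ tw = w∉K (3-cycle⇒K wz zt tw)

  EnteredFromK : V → Set
  EnteredFromK w = ¬ K w × ∃ λ v → K v × E G v w

  EnteredFromK? : ∀ w → Dec (EnteredFromK w)
  EnteredFromK? w = ¬? (K? w) ×-dec any? (λ v → K? v ×-dec E? G v w)

  -- A greatest vertex entered from K must leave through some edge, and every possible
  -- target closes a detour, a 2-cycle or a 3-cycle through it.
  no-greatest-EnteredFromK : ∀ {w} → EnteredFromK w →
                              ¬ (∀ {y} → EnteredFromK y → y ≡ w ⊎ E G y w)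
  no-greatest-EnteredFromK {w} (w∉K , v , v∈K , vw) greatest with successor w
  ... | z , wz with K? z
  ...   | yes z∈K = no-detour v∈K w∉K z∈K vw wz
  ...   | no z∉K with total z v (≢-sym (K-≢ v∈K z∉K))
  ...     | inj₁ zv = w∉K (3-cycle⇒K wz zv vw)
  ...     | inj₂ vz with greatest (z∉K , v , v∈K , vz)
  ...       | inj₁ refl = irrefl z wz
  ...       | inj₂ zw   = w∉K (2-cycle⇒K wz zw)

  outside→K : ∀ {u v} → ¬ K u → K v → E G u v
  outside→K {u} {v} u∉K v∈K with total u v (≢-sym (K-≢ v∈K u∉K))
  ... | inj₁ uv = uv
  ... | inj₂ vu with empty-or-greatest (E G) EnteredFromK? (λ _ _ → total _ _)
                                       (trans-outside ∘ proj₁) (allFin _)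
  ...   | inj₁ none = ⊥-elim (none (∈-allFin u) (u∉K , v , v∈K , vu))
  ...   | inj₂ (w , entered , greatest) =
    ⊥-elim (no-greatest-EnteredFromK entered (greatest (∈-allFin _)))

  K-closed : ∀ {x y} → K x → E G x y → K y
  K-closed {y = y} x∈K xy with K? y
  ... | yes y∈K = y∈K
  ... | no y∉K  = contradiction (2-cycle⇒K (outside→K y∉K x∈K) xy) y∉K

  infix  4 _≼_
  infixl 7 _⊓_

  _≼_ : V → V → Set
  u ≼ v = u ≡ v ⊎ E G u v

  ≼-edge : ∀ {u v w} → ¬ K u → u ≼ v → E G v w → E G u w
  ≼-edge _   (inj₁ refl) vw = vw
  ≼-edge u∉K (inj₂ uv)   vw = trans-outside u∉K uv vw

  ≼-trans : ∀ {u v w} → ¬ K u → u ≼ v → v ≼ w → u ≼ w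
  ≼-trans _   u≼v (inj₁ refl) = u≼v
  ≼-trans u∉K u≼v (inj₂ vw)   = inj₂ (≼-edge u∉K u≼v vw)

  ≼-K : ∀ {u v} → ¬ K u → K v → u ≼ v
  ≼-K u∉K v∈K = inj₂ (outside→K u∉K v∈K)

  ¬edge⇒≼ : ∀ {x y} → ¬ E G x y → y ≼ x
  ¬edge⇒≼ {x} {y} ¬xy with y ≟ x
  ... | yes y≡x = inj₁ y≡x
  ... | no y≢x  = [ inj₂ , (λ xy → contradiction xy ¬xy) ] (total y x y≢x)

  -- The meet for the order in which E points upwards and K lies above everything else.
  _⊓_ : V → V → V
  x ⊓ y with K? x | K? y | E? G x y
  ... | yes _ | _     | _     = y
  ... | no _  | yes _ | _     = x
  ... | no _  | no _  | yes _ = x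
  ... | no _  | no _  | no _  = y

  ⊓-sel : ∀ x y → x ⊓ y ≡ x ⊎ x ⊓ y ≡ y
  ⊓-sel x y with K? x | K? y | E? G x y
  ... | yes _ | _     | _     = inj₂ refl
  ... | no _  | yes _ | _     = inj₁ refl
  ... | no _  | no _  | yes _ = inj₁ refl
  ... | no _  | no _  | no _  = inj₂ refl

  ⊓-idem : ∀ x → x ⊓ x ≡ x
  ⊓-idem x = [ id , id ]′ (⊓-sel x x)

  ⊓-K-left : ∀ {x} y → K x → x ⊓ y ≡ y
  ⊓-K-left {x} y x∈K with K? x
  ... | yes _   = refl
  ... | no x∉K  = contradiction x∈K x∉K

  ⊓-K-right : ∀ {x y} → ¬ K x → K y → x ⊓ y ≡ x
  ⊓-K-right {x} {y} x∉K y∈K with K? x | K? y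
  ... | yes x∈K | _      = contradiction x∈K x∉K
  ... | no _    | yes _  = refl
  ... | no _    | no y∉K = contradiction y∈K y∉K

  ⊓-K : ∀ x y → K (x ⊓ y) → K x × K y
  ⊓-K x y m∈K with K? x | K? y | E? G x y
  ... | yes x∈K | _      | _     = x∈K , m∈K
  ... | no x∉K  | yes _  | _     = contradiction m∈K x∉K
  ... | no x∉K  | no _   | yes _ = contradiction m∈K x∉K
  ... | no _    | no y∉K | no _  = contradiction m∈K y∉K

  ⊓-lower : ∀ x y → ¬ K (x ⊓ y) → x ⊓ y ≼ x × x ⊓ y ≼ y
  ⊓-lower x y m∉K with K? x | K? y | E? G x y
  ... | yes x∈K | _     | _       = ≼-K m∉K x∈K , inj₁ refl
  ... | no _    | yes y∈K | _     = inj₁ refl , ≼-K m∉K y∈K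
  ... | no _    | no _  | yes xy  = inj₁ refl , inj₂ xy
  ... | no _    | no _  | no ¬xy  = ¬edge⇒≼ ¬xy , inj₁ refl

  ⊓₃ : V → V → V → V
  ⊓₃ x y z = x ⊓ (y ⊓ z)

  K³ : V → V → V → Set
  K³ x y z = K x × K y × K z

  ⊓₃-sel : ∀ x y z → ⊓₃ x y z ≡ x ⊎ ⊓₃ x y z ≡ y ⊎ ⊓₃ x y z ≡ z
  ⊓₃-sel x y z = Sum.map₂ (λ m≡yz → Sum.map (trans m≡yz) (trans m≡yz) (⊓-sel y z)) (⊓-sel x (y ⊓ z))

  ⊓₃-∉K : ∀ {x y z} → ¬ K³ x y z → ¬ K (⊓₃ x y z)
  ⊓₃-∉K {x} {y} {z} ¬K³ m∈K with ⊓-K x (y ⊓ z) m∈K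
  ... | x∈K , yz∈K = ¬K³ (x∈K , ⊓-K y z yz∈K)

  ≼-⊓ : ∀ {m} y z → ¬ K m → m ≼ y ⊓ z → m ≼ y × m ≼ z
  ≼-⊓ y z m∉K m≼yz with K? (y ⊓ z)
  ... | yes yz∈K = ≼-K m∉K (proj₁ (⊓-K y z yz∈K)) , ≼-K m∉K (proj₂ (⊓-K y z yz∈K))
  ... | no yz∉K  = ≼-trans m∉K m≼yz (proj₁ (⊓-lower y z yz∉K)) ,
                   ≼-trans m∉K m≼yz (proj₂ (⊓-lower y z yz∉K))

  ⊓₃-lower : ∀ x y z → ¬ K (⊓₃ x y z) → ⊓₃ x y z ≼ x × ⊓₃ x y z ≼ y × ⊓₃ x y z ≼ z
  ⊓₃-lower x y z m∉K with ⊓-lower x (y ⊓ z) m∉K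
  ... | m≼x , m≼yz = m≼x , ≼-⊓ y z m∉K m≼yz

  ⊓₃-preserves-E : ∀ {x y z x′ y′ z′} → ¬ K (⊓₃ x y z) →
    E G x x′ → E G y y′ → E G z z′ → E G (⊓₃ x y z) (⊓₃ x′ y′ z′)
  ⊓₃-preserves-E {x} {y} {z} {x′} {y′} {z′} m∉K xx′ yy′ zz′
    with ⊓₃-lower x y z m∉K | ⊓₃-sel x′ y′ z′
  ... | m≼x , _ , _ | inj₁ m′≡x′        = subst (E G _) (sym m′≡x′) (≼-edge m∉K m≼x xx′)
  ... | _ , m≼y , _ | inj₂ (inj₁ m′≡y′) = subst (E G _) (sym m′≡y′) (≼-edge m∉K m≼y yy′)
  ... | _ , _ , m≼z | inj₂ (inj₂ m′≡z′) = subst (E G _) (sym m′≡z′) (≼-edge m∉K m≼z zz′)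

  majority : V → V → V → V
  majority x y z = if does (y ≟ z) then y else x

  majority-xxy : ∀ x y → majority x x y ≡ x
  majority-xxy x y with x ≟ y
  ... | yes _ = refl
  ... | no _  = refl

  majority-xyy : ∀ x y → majority x y y ≡ y
  majority-xyy x y with y ≟ y
  ... | yes _   = refl
  ... | no y≢y  = contradiction refl y≢y

  majority-xyx : ∀ x y → majority x y x ≡ x
  majority-xyx x y with y ≟ x
  ... | yes y≡x = y≡x
  ... | no _    = refl

  majority-K : ∀ {x y} z → K x → K y → K (majority x y z)
  majority-K {y = y} z x∈K y∈K with y ≟ z
  ... | yes _ = y∈K
  ... | no _  = x∈K

  -- Inside K the edges form a bijection, so whether y = z is transported along edges.
  majority-preserves-E : ∀ {x y z x′ y′ z′} → K³ x y z → K³ x′ y′ z′ →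
    E G x x′ → E G y y′ → E G z z′ → E G (majority x y z) (majority x′ y′ z′)
  majority-preserves-E {y = y} {z} {y′ = y′} {z′} (_ , y∈K , z∈K) (_ , y′∈K , z′∈K) xx′ yy′ zz′
    with y ≟ z | y′ ≟ z′
  ... | yes refl | yes refl  = yy′
  ... | yes refl | no y′≢z′  = contradiction (functional y∈K y′∈K z′∈K yy′ zz′) y′≢z′
  ... | no y≢z   | yes refl  = contradiction (injective y∈K z∈K y′∈K yy′ zz′) y≢z
  ... | no _     | no _      = xx′

  φ : V → V → V → V
  φ x y z with K? x ×-dec K? y ×-dec K? z
  ... | yes _ = majority x y z
  ... | no _  = ⊓₃ x y z

  φ-preserves-E : ∀ {x y z x′ y′ z′} → E G x x′ → E G y y′ → E G z z′ → E G (φ x y z) (φ x′ y′ z′)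
  φ-preserves-E {x} {y} {z} {x′} {y′} {z′} xx′ yy′ zz′
    with K? x ×-dec K? y ×-dec K? z | K? x′ ×-dec K? y′ ×-dec K? z′
  ... | yes K³xyz | yes K³′ = majority-preserves-E K³xyz K³′ xx′ yy′ zz′
  ... | yes (x∈K , y∈K , z∈K) | no ¬K³′ =
    contradiction (K-closed x∈K xx′ , K-closed y∈K yy′ , K-closed z∈K zz′) ¬K³′
  ... | no ¬K³ | yes (x′∈K , y′∈K , _) = outside→K (⊓₃-∉K ¬K³) (majority-K z′ x′∈K y′∈K)
  ... | no ¬K³ | no _ = ⊓₃-preserves-E (⊓₃-∉K ¬K³) xx′ yy′ zz′

  φ-idempotent : ∀ x → φ x x x ≡ x
  φ-idempotent x with K? x ×-dec K? x ×-dec K? x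
  ... | yes _ = majority-xxy x x
  ... | no _  = trans (cong (x ⊓_) (⊓-idem x)) (⊓-idem x)

  φ-K : ∀ {x y z} → K³ x y z → φ x y z ≡ majority x y z
  φ-K {x} {y} {z} K³xyz with K? x ×-dec K? y ×-dec K? z
  ... | yes _  = refl
  ... | no ¬K³ = contradiction K³xyz ¬K³

  φ-absorbˡ-K : ∀ {x y} → K x → ¬ K y → φ x x y ≡ y
  φ-absorbˡ-K {x} {y} x∈K y∉K with K? x ×-dec K? x ×-dec K? y
  ... | yes (_ , _ , y∈K) = contradiction y∈K y∉K
  ... | no _              = trans (⊓-K-left (x ⊓ y) x∈K) (⊓-K-left y x∈K)

  φ-absorbʳ-K : ∀ {x y} → ¬ K x → K y → φ x x y ≡ x
  φ-absorbʳ-K {x} {y} x∉K y∈K with K? x ×-dec K? x ×-dec K? y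
  ... | yes (x∈K , _) = contradiction x∈K x∉K
  ... | no _          = trans (cong (x ⊓_) (⊓-K-right x∉K y∈K)) (⊓-idem x)

  open Evaluation φ

  module Generators (m : ℕ) (j₀ : Fin m) where

    Index : Set
    Index = Fin m × Fin m × V × V

    generator : Index → Fin m → V
    generator (a , b , x , y) j = if does (j ≟ a) then x else if does (j ≟ b) then y else κ

    constant-κ : Index
    constant-κ = j₀ , j₀ , κ , κ

    generator-κ : ∀ j → generator constant-κ j ≡ κ
    generator-κ j with j ≟ j₀
    ... | yes _ = refl
    ... | no _  = refl

    restrict : ∀ {k} → (Fin m → V) → Vec (Fin m) k → Fin m → V
    restrict s []       j = κ
    restrict s (i ∷ is) j = if does (j ≟ i) then s j else restrict s is j

    restrict-∈ : ∀ s {k} {is : Vec (Fin m) k} {j} → j ∈ᵛ is → restrict s is j ≡ s j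
    restrict-∈ s {is = i ∷ _} {j} (VecAny.here j≡i) with j ≟ i
    ... | yes _  = refl
    ... | no j≢i = contradiction j≡i j≢i
    restrict-∈ s {is = i ∷ _} {j} (VecAny.there j∈is) with j ≟ i
    ... | yes _ = refl
    ... | no _  = restrict-∈ s j∈is

    restrict-cases : ∀ s {k} (is : Vec (Fin m) k) j → restrict s is j ≡ s j ⊎ restrict s is j ≡ κ
    restrict-cases s []       j = inj₂ refl
    restrict-cases s (i ∷ is) j with j ≟ i
    ... | yes _ = inj₁ refl
    ... | no _  = restrict-cases s is j

    restrict-K : ∀ {s} → (∀ j → K (s j)) → ∀ {k} (is : Vec (Fin m) k) j → K (restrict s is j)
    restrict-K {s} s∈K is j =
      [ (λ r≡sj → subst K (sym r≡sj) (s∈K j)) , (λ r≡κ → subst K (sym r≡κ) κ∈K) ]′ (restrict-cases s is j)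

    -- The usual majority recursion: a tuple agreeing with s on a, b, c, … is the majority of
    -- the three tuples obtained by forgetting one of a, b, c.
    majorityTerm : ∀ {k} → (Fin m → V) → Vec (Fin m) k → Term Index
    majorityTerm s []               = var constant-κ
    majorityTerm s (a ∷ [])         = var (a , a , s a , s a)
    majorityTerm s (a ∷ b ∷ [])     = var (a , b , s a , s b)
    majorityTerm s (a ∷ b ∷ c ∷ is) =
      node (majorityTerm s (b ∷ c ∷ is)) (majorityTerm s (a ∷ c ∷ is)) (majorityTerm s (a ∷ b ∷ is))

    majority-restrict : ∀ s a b c {k} (is : Vec (Fin m) k) j →
      majority (restrict s (b ∷ c ∷ is) j) (restrict s (a ∷ c ∷ is) j) (restrict s (a ∷ b ∷ is) j)
        ≡ restrict s (a ∷ b ∷ c ∷ is) j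
    majority-restrict s a b c is j with j ≟ a | j ≟ b | j ≟ c
    ... | yes _ | _     | _     = majority-xyy _ (s j)
    ... | no _  | yes _ | j≟c   = majority-xyx (s j) (if does j≟c then s j else restrict s is j)
    ... | no _  | no _  | yes _ = majority-xxy (s j) (restrict s is j)
    ... | no _  | no _  | no _  = majority-xxy (restrict s is j) (restrict s is j)

    majorityTerm-correct : ∀ s → (∀ j → K (s j)) → ∀ {k} (is : Vec (Fin m) k) j →
      ⟦ majorityTerm s is ⟧ (λ q → generator q j) ≡ restrict s is j
    majorityTerm-correct s s∈K [] j = generator-κ j
    majorityTerm-correct s s∈K (a ∷ []) j with j ≟ a
    ... | yes refl = refl
    ... | no _     = refl
    majorityTerm-correct s s∈K (a ∷ b ∷ []) j with j ≟ a | j ≟ b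
    ... | yes refl | _        = refl
    ... | no _     | yes refl = refl
    ... | no _     | no _     = refl
    majorityTerm-correct s s∈K (a ∷ b ∷ c ∷ is) j =
      trans (cong-op (majorityTerm-correct s s∈K (b ∷ c ∷ is) j)
                     (majorityTerm-correct s s∈K (a ∷ c ∷ is) j)
                     (majorityTerm-correct s s∈K (a ∷ b ∷ is) j))
            (trans (φ-K (restrict-K s∈K (b ∷ c ∷ is) j , restrict-K s∈K (a ∷ c ∷ is) j ,
                         restrict-K s∈K (a ∷ b ∷ is) j))
                   (majority-restrict s a b c is j))

    κ-or-∉K : V → Set
    κ-or-∉K x = x ≡ κ ⊎ ¬ K x

    φ-xxr : ∀ {x r} → κ-or-∉K x → r ≡ x ⊎ r ≡ κ → φ x x r ≡ x
    φ-xxr _            (inj₁ refl) = φ-idempotent _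
    φ-xxr (inj₁ refl)  (inj₂ refl) = φ-idempotent κ
    φ-xxr (inj₂ x∉K)   (inj₂ refl) = φ-absorbʳ-K x∉K κ∈K

    φ-κκr : ∀ {x r} → κ-or-∉K x → r ≡ x ⊎ r ≡ κ → φ κ κ r ≡ r
    φ-κκr (inj₁ refl) (inj₁ refl) = φ-idempotent κ
    φ-κκr (inj₂ x∉K)  (inj₁ refl) = φ-absorbˡ-K κ∈K x∉K
    φ-κκr _           (inj₂ refl) = φ-idempotent κ

    -- On tuples with entries κ or outside K, φ(x, x, −) acts as a join with neutral element κ.
    joinTerm : ∀ {k} → (Fin m → V) → Vec (Fin m) k → Term Index
    joinTerm s []       = var constant-κ
    joinTerm s (i ∷ is) = node (var (i , i , s i , s i)) (var (i , i , s i , s i)) (joinTerm s is)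

    joinTerm-correct : ∀ s → (∀ j → κ-or-∉K (s j)) → ∀ {k} (is : Vec (Fin m) k) j →
      ⟦ joinTerm s is ⟧ (λ q → generator q j) ≡ restrict s is j
    joinTerm-correct s s-low [] j = generator-κ j
    joinTerm-correct s s-low (i ∷ is) j rewrite joinTerm-correct s s-low is j with j ≟ i
    ... | yes refl = φ-xxr (s-low j) (restrict-cases s is j)
    ... | no _     = φ-κκr (s-low j) (restrict-cases s is j)

    K-part outside-part : V → V
    K-part       x = if does (K? x) then x else κ
    outside-part x = if does (K? x) then κ else x

    K-part-K : ∀ x → K (K-part x)
    K-part-K x with K? x
    ... | yes x∈K = x∈K
    ... | no _    = κ∈K

    outside-part-low : ∀ x → κ-or-∉K (outside-part x)
    outside-part-low x with K? x
    ... | yes _   = inj₁ refl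
    ... | no x∉K  = inj₂ x∉K

    φ-split : ∀ x → φ (K-part x) (K-part x) (outside-part x) ≡ x
    φ-split x with K? x
    ... | yes x∈K = trans (φ-K (x∈K , x∈K , κ∈K)) (majority-xxy x κ)
    ... | no x∉K  = φ-absorbˡ-K κ∈K x∉K

    term : (Fin m → V) → Term Index
    term t = node (majorityTerm (K-part ∘ t) (allFinᵛ m)) (majorityTerm (K-part ∘ t) (allFinᵛ m))
                  (joinTerm (outside-part ∘ t) (allFinᵛ m))

    term-correct : ∀ t j → ⟦ term t ⟧ (λ q → generator q j) ≡ t j
    term-correct t j
      rewrite majorityTerm-correct (K-part ∘ t) (K-part-K ∘ t) (allFinᵛ m) j
            | joinTerm-correct (outside-part ∘ t) (outside-part-low ∘ t) (allFinᵛ m) j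
            | restrict-∈ (K-part ∘ t) (∈-allFin⁺ j)
            | restrict-∈ (outside-part ∘ t) (∈-allFin⁺ j)
      = φ-split (t j)

    encode : Index → Fin (n G * n G * (m * m))
    encode (a , b , x , y) = combine (combine x y) (combine a b)

    merge : Fin m × Fin m → V × V → Index
    merge ab xy = proj₁ ab , proj₂ ab , proj₁ xy , proj₂ xy

    decode : Fin (n G * n G * (m * m)) → Index
    decode i = merge (remQuot m (proj₂ xy,ab)) (remQuot (n G) (proj₁ xy,ab))
      where xy,ab = remQuot (m * m) i

    decode∘encode : ∀ q → decode (encode q) ≡ q
    decode∘encode (a , b , x , y) = begin
      decode (combine (combine x y) (combine a b))
        ≡⟨ cong (λ p → merge (remQuot m (proj₂ p)) (remQuot (n G) (proj₁ p)))
                (remQuot-combine (combine x y) (combine a b)) ⟩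
      merge (remQuot m (combine a b)) (remQuot (n G) (combine x y))
        ≡⟨ cong₂ merge (remQuot-combine a b) (remQuot-combine x y) ⟩
      (a , b , x , y) ∎
      where open ≡-Reasoning

  generating-set : ∀ m → Fin m →
    Σ (List (Fin m → V)) λ S → Generates G m S × length S ≤ n G * n G * m ^ 2
  generating-set m j₀ =
    tabulate (generator ∘ decode) ,
    Generates-tabulate G φ φ-preserves-E φ-idempotent generator encode decode decode∘encode
                       (λ t → term t , term-correct t) ,
    ≤-reflexive (trans (length-tabulate (generator ∘ decode))
                       (cong (λ k → n G * n G * (m * k)) (sym (*-identityʳ m))))
    where open Generators m j₀

proposition2 : (G : Digraph) → Semicomplete G → ExactlyOneCycle G →
    ¬ HasSourceAndSink G → HasPGP G
proposition2 G sc (c , c-cycle , c-unique) ¬source×sink =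
  2 , n G * n G , 1 , λ { (suc m) _ → generating-set-of-size (suc m) zero }
  where
    U : IsUniqueCycle G (_∈ c)
    U = isUniqueCycle sc c c-cycle c-unique

    -- With a sink there is no source, and reversing the edges turns sources into sinks.
    generating-set-of-size : ∀ m → Fin m →
      Σ (List (Fin m → Vertex G)) λ S → Generates G m S × length S ≤ n G * n G * m ^ 2
    generating-set-of-size m j₀ with any? (λ x → all? (λ y → ¬? (E? G x y)))
    ... | no ¬sink = Construction.generating-set U (¬sink⇒successor G ¬sink) m j₀
    ... | yes sink
      with Construction.generating-set (converse-IsUniqueCycle U)
             (¬sink⇒successor (converse G) (λ source → ¬source×sink (source , sink))) m j₀
    ...   | S , generates , size = S , Generates-converse G S generates , size
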